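{- Let $k$ be an even integer, $s$ an integer, and let $H$ be a graph on $2k-1-2s$ vertices in which every vertex has degree $k-1$ except exactly one vertex, which has degree $k-2$. Then $$\mathcal{N}(K_3,H)\le \frac{1}{6}(2k-1-2s)\Big((k-1)(k-2)-(k-1-2s)(2s+1)\Big)+\frac{1}{2}-s.$$
   Context: $\mathcal{N}(K_3,H)$ denotes the number of triangles in the graph $H$. -}

module Defs where

open import Data.Bool using (Bool; true; false; T)
open import Data.Nat using (ℕ; _<_)
open import Data.Fin using (Fin; toℕ)
open import Data.List using (List; length; filter; allFin; concatMap; map; _∷_; [])
open import Data.Product using (_×_; _,_)
open import Relation.Binary.PropositionalEquality using (_≡_)
open import Relation.Nullary using (¬_)
open import Relation.Nullary.Decidable using (Dec; yes; no; _×-dec_)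
open import Data.Bool.Properties using (T?)
open import Data.Nat.Properties using (_<?_)
open import Data.Fin.Properties using (_≟_)

record Graph (n : ℕ) : Set where
  field
    adj   : Fin n → Fin n → Bool
    sym   : ∀ u v → adj u v ≡ adj v u
    loopless : ∀ v → adj v v ≡ false
open Graph public

degree : ∀ {n} → Graph n → Fin n → ℕ
degree {n} G v = length (filter (λ w → T? (adj G v w)) (allFin n))

triples : (n : ℕ) → List (Fin n × Fin n × Fin n)
triples n = concatMap (λ a → concatMap (λ b → map (λ c → (a , b , c)) (allFin n)) (allFin n)) (allFin n)

-- a triangle, listed once as a < b < c with all three pairs adjacent
IsTriangle : ∀ {n} → Graph n → Fin n × Fin n × Fin n → Set
IsTriangle G (a , b , c) =
  (toℕ a < toℕ b) × (toℕ b < toℕ c) × T (adj G a b) × T (adj G b c) × T (adj G a c)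

isTriangle? : ∀ {n} (G : Graph n) (t : Fin n × Fin n × Fin n) → Dec (IsTriangle G t)
isTriangle? G (a , b , c) =
  (toℕ a <? toℕ b) ×-dec (toℕ b <? toℕ c) ×-dec T? (adj G a b) ×-dec T? (adj G b c) ×-dec T? (adj G a c)

numTriangles : ∀ {n} → Graph n → ℕ
numTriangles {n} G = length (filter (isTriangle? G) (triples n))

-- Fix a vertex v and split the remaining vertices into its neighbours N and its other
-- non-neighbours R. Counting the edges at the vertices of N gives
-- 2e(N) = Σ_{u∈N} d(u) − d(v) − e(N,R), and counting them at R gives
-- e(N,R) = Σ_{u∈R} d(u) − 2e(R) ≥ Σ_{u∈R} d(u) − |R|(|R| − 1). Every triangle is counted
-- six times in Σ_v 2e(N(v)), so summing over v yields Goodman's bound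
-- 6 N(K₃,G) ≤ Σ_v [(n − 1)(n − 2) − 3 d(v)(n − 1 − d(v))],
-- and for the given degree sequence the right-hand side is the stated polynomial.

module Submission where

open import Defs hiding (sym)
open import Data.Nat using (ℕ; zero; suc; _<_; _<?_; z≤n)
open import Data.Fin using (Fin; zero; suc; toℕ)
open import Data.Integer using (ℤ; +_; _+_; _-_; _*_; _≤_; -_; 0ℤ; 1ℤ; +≤+)
open import Data.Product using (Σ; _×_; _,_)
open import Data.Sum using (_⊎_; inj₁; inj₂)
open import Data.Bool using (Bool; true; false; _∧_; not)
open import Data.Bool.Properties using (T?)
open import Data.Fin.Properties using (_≟_; toℕ-injective)
open import Data.List using (List; length; filter; tabulate; concatMap; map; _++_; allFin)
open import Data.List.Properties using (filter-++; length-++; map-tabulate)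
open import Function using (_∘_)
open import Relation.Binary.PropositionalEquality
open import Relation.Binary.Definitions using (tri<; tri≈; tri>)
open import Relation.Nullary using (¬_; contradiction)
open import Relation.Nullary.Decidable using (does; yes; no; dec-true; dec-false)
open import Relation.Unary using (Pred; Decidable)
import Data.Nat as Nat
import Data.Nat.Properties as ℕ
import Data.Integer.Properties as ℤ
open import Algebra.Properties.Semiring.Sum ℤ.+-*-semiring
  using (sum; sum-syntax; sum-replicate-zero; sum-cong-≗; ∑-comm; ∑-distrib-+; *-distribˡ-sum; *-distribʳ-sum)
open import Data.Integer.Tactic.RingSolver using (solve-∀)

private
  variable
    n : ℕ

𝟙 : Bool → ℤ
𝟙 true  = 1ℤ
𝟙 false = 0ℤ

𝟙-∧ : ∀ a b → 𝟙 (a ∧ b) ≡ 𝟙 a * 𝟙 b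
𝟙-∧ true  b = sym (ℤ.*-identityˡ (𝟙 b))
𝟙-∧ false b = refl

𝟙-idem : ∀ b → 𝟙 b * 𝟙 b ≡ 𝟙 b
𝟙-idem true  = refl
𝟙-idem false = refl

∑-neg : (f : Fin n → ℤ) → ∑[ i < n ] (- f i) ≡ - ∑[ i < n ] f i
∑-neg {zero}  f = refl
∑-neg {suc n} f = trans (cong (_+_ (- f zero)) (∑-neg (f ∘ suc))) (sym (ℤ.neg-distrib-+ (f zero) _))

∑-distrib-- : (f g : Fin n → ℤ) → ∑[ i < n ] (f i - g i) ≡ ∑[ i < n ] f i - ∑[ i < n ] g i
∑-distrib-- f g = trans (∑-distrib-+ f (λ i → - g i)) (cong (_+_ (sum f)) (∑-neg g))

∑-const : ∀ n (c : ℤ) → ∑[ i < n ] c ≡ + n * c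
∑-const zero    c = refl
∑-const (suc n) c = begin
  c + ∑[ i < n ] c  ≡⟨ cong (_+_ c) (∑-const n c) ⟩
  c + + n * c       ≡⟨ cong (_+ + n * c) (ℤ.*-identityˡ c) ⟨
  1ℤ * c + + n * c  ≡⟨ ℤ.*-distribʳ-+ c 1ℤ (+ n) ⟨
  + suc n * c       ∎
  where open ≡-Reasoning

∑-mono-≤ : {f g : Fin n → ℤ} → (∀ i → f i ≤ g i) → ∑[ i < n ] f i ≤ ∑[ i < n ] g i
∑-mono-≤ {zero}  f≤g = ℤ.≤-refl
∑-mono-≤ {suc n} f≤g = ℤ.+-mono-≤ (f≤g zero) (∑-mono-≤ (f≤g ∘ suc))

δ : Fin n → Fin n → ℤ
δ i j = 𝟙 (does (i ≟ j))

∑-δ : (f : Fin n → ℤ) (j : Fin n) → ∑[ i < n ] (δ i j * f i) ≡ f j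
∑-δ {suc n} f zero = trans (cong₂ _+_ (ℤ.*-identityˡ (f zero)) (sum-replicate-zero n)) (ℤ.+-identityʳ (f zero))
∑-δ {suc n} f (suc j) = trans (ℤ.+-identityˡ _) (∑-δ (f ∘ suc) j)

∑-combination : (f g h : Fin n → ℤ) →
  ∑[ i < n ] (+ 2 * f i - g i + h i) ≡ + 2 * ∑[ i < n ] f i - ∑[ i < n ] g i + ∑[ i < n ] h i
∑-combination f g h = begin
  ∑[ i < _ ] (+ 2 * f i - g i + h i)             ≡⟨ ∑-distrib-+ (λ i → + 2 * f i - g i) h ⟩
  ∑[ i < _ ] (+ 2 * f i - g i) + sum h           ≡⟨ cong (λ z → z + sum h) (∑-distrib-- (λ i → + 2 * f i) g) ⟩
  ∑[ i < _ ] (+ 2 * f i) - sum g + sum h         ≡⟨ cong (λ z → z - sum g + sum h) (*-distribˡ-sum (+ 2) f) ⟨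
  + 2 * sum f - sum g + sum h                    ∎
  where open ≡-Reasoning

∑-almost-constant : (f : Fin n → ℤ) (j : Fin n) (c : ℤ) → (∀ i → i ≢ j → f i ≡ c) →
  ∑[ i < n ] f i ≡ + n * c + (f j - c)
∑-almost-constant {n} f j c f≡c = begin
  ∑[ i < n ] f i                         ≡⟨ sum-cong-≗ deviation ⟩
  ∑[ i < n ] (c + δ i j * (f j - c))     ≡⟨ ∑-distrib-+ (λ _ → c) (λ i → δ i j * (f j - c)) ⟩
  ∑[ i < n ] c + ∑[ i < n ] (δ i j * (f j - c)) ≡⟨ cong₂ _+_ (∑-const n c) (∑-δ (λ _ → f j - c) j) ⟩
  + n * c + (f j - c)                    ∎
  where
  open ≡-Reasoning
  deviation : ∀ i → f i ≡ c + δ i j * (f j - c)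
  deviation i with i ≟ j
  ... | yes refl = sym (trans (cong (_+_ c) (ℤ.*-identityˡ (f i - c))) (restore c (f i)))
    where
    restore : ∀ c a → c + (a - c) ≡ a
    restore = solve-∀
  ... | no i≢j = trans (f≡c i i≢j) (sym (ℤ.+-identityʳ c))

module _ {a p} {A : Set a} {P : Pred A p} (P? : Decidable P) where

  length-filter-tabulate : (f : Fin n → A) →
    + length (filter P? (tabulate f)) ≡ ∑[ i < n ] 𝟙 (does (P? (f i)))
  length-filter-tabulate {zero}  f = refl
  length-filter-tabulate {suc n} f with does (P? (f zero))
  ... | true  = trans (ℤ.pos-+ 1 _) (cong (_+_ 1ℤ) (length-filter-tabulate (f ∘ suc)))
  ... | false = trans (length-filter-tabulate (f ∘ suc)) (sym (ℤ.+-identityˡ _))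

  length-filter-concatMap : ∀ {b} {B : Set b} (g : B → List A) (f : Fin n → B) →
    + length (filter P? (concatMap g (tabulate f))) ≡ ∑[ i < n ] (+ length (filter P? (g (f i))))
  length-filter-concatMap {n = zero}  g f = refl
  length-filter-concatMap {n = suc n} g f = begin
    + length (filter P? (g (f zero) ++ rest))            ≡⟨ cong (+_ ∘ length) (filter-++ P? (g (f zero)) rest) ⟩
    + length (filter P? (g (f zero)) ++ filter P? rest)  ≡⟨ cong +_ (length-++ (filter P? (g (f zero)))) ⟩
    + (length (filter P? (g (f zero))) Nat.+ length (filter P? rest))
      ≡⟨ ℤ.pos-+ (length (filter P? (g (f zero)))) (length (filter P? rest)) ⟩
    + length (filter P? (g (f zero))) + + length (filter P? rest)
      ≡⟨ cong (_+_ (+ length (filter P? (g (f zero))))) (length-filter-concatMap g (f ∘ suc)) ⟩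
    ∑[ i < suc n ] (+ length (filter P? (g (f i))))      ∎
    where
    open ≡-Reasoning
    rest : List A
    rest = concatMap g (tabulate (f ∘ suc))

length-filter-triples : ∀ {p} {P : Pred (Fin n × Fin n × Fin n) p} (P? : Decidable P) →
  + length (filter P? (triples n)) ≡ ∑[ a < n ] ∑[ b < n ] ∑[ c < n ] 𝟙 (does (P? (a , b , c)))
length-filter-triples {n} P? =
  trans (length-filter-concatMap P? (λ a → concatMap (λ b → map (λ c → (a , b , c)) (allFin n)) (allFin n)) (λ a → a))
    (sum-cong-≗ λ a → trans (length-filter-concatMap P? (λ b → map (λ c → (a , b , c)) (allFin n)) (λ b → b))
      (sum-cong-≗ λ b → trans (cong (+_ ∘ length ∘ filter P?) (map-tabulate (λ c → c) (λ c → (a , b , c))))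
        (length-filter-tabulate P? (λ c → (a , b , c)))))

ord : ℕ → ℕ → ℤ
ord x y = 𝟙 (does (x <? y))

ord-< : ∀ {x y} → x < y → ord x y ≡ 1ℤ
ord-< {x} {y} x<y = cong 𝟙 (dec-true (x <? y) x<y)

ord-≮ : ∀ {x y} → ¬ x < y → ord x y ≡ 0ℤ
ord-≮ {x} {y} x≮y = cong 𝟙 (dec-false (x <? y) x≮y)

orderings : ℕ → ℕ → ℕ → ℤ
orderings x y z = ord x y * ord y z + ord x z * ord z y + (ord y x * ord x z + ord y z * ord z x)
                + (ord z x * ord x y + ord z y * ord y x)

orderings-swap₁₂ : ∀ x y z → orderings x y z ≡ orderings y x z
orderings-swap₁₂ x y z = permute (ord x y) (ord y x) (ord y z) (ord z y) (ord x z) (ord z x)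
  where
  permute : ∀ xy yx yz zy xz zx →
    xy * yz + xz * zy + (yx * xz + yz * zx) + (zx * xy + zy * yx) ≡
    yx * xz + yz * zx + (xy * yz + xz * zy) + (zy * yx + zx * xy)
  permute = solve-∀

orderings-swap₂₃ : ∀ x y z → orderings x y z ≡ orderings x z y
orderings-swap₂₃ x y z = permute (ord x y) (ord y x) (ord y z) (ord z y) (ord x z) (ord z x)
  where
  permute : ∀ xy yx yz zy xz zx →
    xy * yz + xz * zy + (yx * xz + yz * zx) + (zx * xy + zy * yx) ≡
    xz * zy + xy * yz + (zx * xy + zy * yx) + (yx * xz + yz * zx)
  permute = solve-∀

orderings-sorted : ∀ {x y z} → x < y → y < z → orderings x y z ≡ 1ℤ
orderings-sorted x<y y<z
  rewrite ord-< x<y | ord-< y<z | ord-< (ℕ.<-trans x<y y<z)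
        | ord-≮ (ℕ.<⇒≯ x<y) | ord-≮ (ℕ.<⇒≯ y<z) | ord-≮ (ℕ.<⇒≯ (ℕ.<-trans x<y y<z)) = refl

orderings-distinct : ∀ {x y z} → x ≢ y → y ≢ z → x ≢ z → orderings x y z ≡ 1ℤ
orderings-distinct {x} {y} {z} x≢y y≢z x≢z with ℕ.<-cmp x y | ℕ.<-cmp y z | ℕ.<-cmp x z
... | tri≈ _ x≡y _ | _ | _ = contradiction x≡y x≢y
... | _ | tri≈ _ y≡z _ | _ = contradiction y≡z y≢z
... | _ | _ | tri≈ _ x≡z _ = contradiction x≡z x≢z
... | tri< x<y _ _ | tri< y<z _ _ | _ = orderings-sorted x<y y<z
... | tri< x<y _ _ | tri> _ _ z<y | tri< x<z _ _ = trans (orderings-swap₂₃ x y z) (orderings-sorted x<z z<y)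
... | tri< x<y _ _ | tri> _ _ z<y | tri> _ _ z<x =
  trans (orderings-swap₂₃ x y z) (trans (orderings-swap₁₂ x z y) (orderings-sorted z<x x<y))
... | tri> _ _ y<x | tri< y<z _ _ | tri< x<z _ _ = trans (orderings-swap₁₂ x y z) (orderings-sorted y<x x<z)
... | tri> _ _ y<x | tri< y<z _ _ | tri> _ _ z<x =
  trans (orderings-swap₁₂ x y z) (trans (orderings-swap₂₃ y x z) (orderings-sorted y<z z<x))
... | tri> _ _ y<x | tri> _ _ z<y | _ =
  trans (orderings-swap₁₂ x y z) (trans (orderings-swap₂₃ y x z) (trans (orderings-swap₁₂ y z x) (orderings-sorted z<y y<x)))

∑³ : (Fin n → Fin n → Fin n → ℤ) → ℤ
∑³ {n} f = ∑[ a < n ] ∑[ b < n ] ∑[ c < n ] f a b c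

∑³-cong : {f g : Fin n → Fin n → Fin n → ℤ} → (∀ a b c → f a b c ≡ g a b c) → ∑³ f ≡ ∑³ g
∑³-cong f≡g = sum-cong-≗ λ a → sum-cong-≗ λ b → sum-cong-≗ (f≡g a b)

∑³-distrib-+ : (f g : Fin n → Fin n → Fin n → ℤ) → ∑³ (λ a b c → f a b c + g a b c) ≡ ∑³ f + ∑³ g
∑³-distrib-+ {n} f g =
  trans (sum-cong-≗ λ a → trans (sum-cong-≗ λ b → ∑-distrib-+ (f a b) (g a b)) (∑-distrib-+ (∑₁ f a) (∑₁ g a)))
        (∑-distrib-+ (λ a → sum (∑₁ f a)) (λ a → sum (∑₁ g a)))
  where
  ∑₁ : (Fin n → Fin n → Fin n → ℤ) → Fin n → Fin n → ℤ
  ∑₁ h a b = ∑[ c < n ] h a b c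

∑³-swap₁₂ : (f : Fin n → Fin n → Fin n → ℤ) → ∑³ (λ a b c → f b a c) ≡ ∑³ f
∑³-swap₁₂ {n} f = ∑-comm (λ a b → ∑[ c < n ] f b a c)

∑³-swap₂₃ : (f : Fin n → Fin n → Fin n → ℤ) → ∑³ (λ a b c → f a c b) ≡ ∑³ f
∑³-swap₂₃ f = sum-cong-≗ λ a → ∑-comm (λ b c → f a c b)

∑³-transpositions : (f : Fin n → Fin n → Fin n → ℤ) → ∑³ (λ a b c → f a b c + f a c b) ≡ + 2 * ∑³ f
∑³-transpositions f = begin
  ∑³ (λ a b c → f a b c + f a c b)  ≡⟨ ∑³-distrib-+ f (λ a b c → f a c b) ⟩
  ∑³ f + ∑³ (λ a b c → f a c b)     ≡⟨ cong (_+_ (∑³ f)) (∑³-swap₂₃ f) ⟩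
  ∑³ f + ∑³ f                       ≡⟨ double (∑³ f) ⟩
  + 2 * ∑³ f                        ∎
  where
  open ≡-Reasoning
  double : ∀ x → x + x ≡ + 2 * x
  double = solve-∀

∑³-cosets : (f : Fin n → Fin n → Fin n → ℤ) → ∑³ (λ a b c → f a b c + f b a c + f c a b) ≡ + 3 * ∑³ f
∑³-cosets f = begin
  ∑³ (λ a b c → f a b c + f b a c + f c a b)
    ≡⟨ ∑³-distrib-+ (λ a b c → f a b c + f b a c) (λ a b c → f c a b) ⟩
  ∑³ (λ a b c → f a b c + f b a c) + ∑³ (λ a b c → f c a b)
    ≡⟨ cong₂ _+_ (∑³-distrib-+ f (λ a b c → f b a c)) (∑³-swap₂₃ (λ a b c → f b a c)) ⟩
  ∑³ f + ∑³ (λ a b c → f b a c) + ∑³ (λ a b c → f b a c)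
    ≡⟨ cong₂ (λ u v → ∑³ f + u + v) (∑³-swap₁₂ f) (∑³-swap₁₂ f) ⟩
  ∑³ f + ∑³ f + ∑³ f
    ≡⟨ triple (∑³ f) ⟩
  + 3 * ∑³ f ∎
  where
  open ≡-Reasoning
  triple : ∀ x → x + x + x ≡ + 3 * x
  triple = solve-∀

ordered : (Fin n → Fin n → Fin n → ℤ) → Fin n → Fin n → Fin n → ℤ
ordered f a b c = ord (toℕ a) (toℕ b) * (ord (toℕ b) (toℕ c) * f a b c)

module _ (f : Fin n → Fin n → Fin n → ℤ)
         (f-swap₁₂ : ∀ a b c → f b a c ≡ f a b c)
         (f-swap₂₃ : ∀ a b c → f a c b ≡ f a b c)
         (f-diagonal : ∀ a c → f a a c ≡ 0ℤ)
         where

  private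
    f-vanishes : ∀ {a b c} → a ≡ b ⊎ b ≡ c ⊎ a ≡ c → f a b c ≡ 0ℤ
    f-vanishes {a} {c = c} (inj₁ refl) = f-diagonal a c
    f-vanishes {a} {b} (inj₂ (inj₁ refl)) = trans (sym (f-swap₁₂ a b b)) (trans (f-swap₂₃ b b a) (f-diagonal b a))
    f-vanishes {a} {b} (inj₂ (inj₂ refl)) = trans (f-swap₂₃ a a b) (f-diagonal a b)

    vanishing : ∀ {a b c} → a ≡ b ⊎ b ≡ c ⊎ a ≡ c → orderings (toℕ a) (toℕ b) (toℕ c) * f a b c ≡ f a b c
    vanishing {a} {b} {c} eq rewrite f-vanishes eq = ℤ.*-zeroʳ (orderings (toℕ a) (toℕ b) (toℕ c))

  orderings-absorb : ∀ a b c → orderings (toℕ a) (toℕ b) (toℕ c) * f a b c ≡ f a b c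
  orderings-absorb a b c with a ≟ b | b ≟ c | a ≟ c
  ... | yes a≡b | _       | _       = vanishing (inj₁ a≡b)
  ... | _       | yes b≡c | _       = vanishing (inj₂ (inj₁ b≡c))
  ... | _       | _       | yes a≡c = vanishing (inj₂ (inj₂ a≡c))
  ... | no a≢b  | no b≢c  | no a≢c  = begin
    orderings (toℕ a) (toℕ b) (toℕ c) * f a b c
      ≡⟨ cong (_* f a b c) (orderings-distinct (a≢b ∘ toℕ-injective) (b≢c ∘ toℕ-injective) (a≢c ∘ toℕ-injective)) ⟩
    1ℤ * f a b c ≡⟨ ℤ.*-identityˡ (f a b c) ⟩
    f a b c ∎
    where open ≡-Reasoning

  private
    f-bca : ∀ a b c → f b c a ≡ f a b c
    f-bca a b c = trans (f-swap₂₃ b a c) (f-swap₁₂ a b c)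

    f-cab : ∀ a b c → f c a b ≡ f a b c
    f-cab a b c = trans (f-swap₁₂ a c b) (f-swap₂₃ a b c)

    f-cba : ∀ a b c → f c b a ≡ f a b c
    f-cba a b c = trans (f-swap₂₃ c a b) (f-cab a b c)

    transposed : Fin n → Fin n → Fin n → ℤ
    transposed a b c = ordered f a b c + ordered f a c b

  -- The six orderings of a, b, c, grouped into the three cosets of the transposition of b and c.
  transposed-cosets : ∀ a b c → transposed a b c + transposed b a c + transposed c a b ≡ f a b c
  transposed-cosets a b c rewrite f-swap₂₃ a b c | f-swap₁₂ a b c | f-bca a b c | f-cab a b c | f-cba a b c =
    trans (collect (ord (toℕ a) (toℕ b)) (ord (toℕ b) (toℕ a)) (ord (toℕ b) (toℕ c)) (ord (toℕ c) (toℕ b))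
                   (ord (toℕ a) (toℕ c)) (ord (toℕ c) (toℕ a)) (f a b c))
          (orderings-absorb a b c)
    where
    collect : ∀ xy yx yz zy xz zx u →
      xy * (yz * u) + xz * (zy * u) + (yx * (xz * u) + yz * (zx * u)) + (zx * (xy * u) + zy * (yx * u))
      ≡ (xy * yz + xz * zy + (yx * xz + yz * zx) + (zx * xy + zy * yx)) * u
    collect = solve-∀

  ∑³-symmetric : ∑³ f ≡ + 6 * ∑³ (ordered f)
  ∑³-symmetric = begin
    ∑³ f                                                          ≡⟨ ∑³-cong transposed-cosets ⟨
    ∑³ (λ a b c → transposed a b c + transposed b a c + transposed c a b) ≡⟨ ∑³-cosets transposed ⟩
    + 3 * ∑³ transposed                                           ≡⟨ cong (+ 3 *_) (∑³-transpositions (ordered f)) ⟩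
    + 3 * (+ 2 * ∑³ (ordered f))                                  ≡⟨ ℤ.*-assoc (+ 3) (+ 2) _ ⟨
    + 6 * ∑³ (ordered f)                                          ∎
    where open ≡-Reasoning

goodman : ℤ → ℤ → ℤ
goodman m d = (m - 1ℤ) * (m - + 2) - + 3 * (d * (m - 1ℤ - d))
-- Inlined so that the ring solver sees the polynomial rather than an opaque name.
{-# INLINE goodman #-}

module _ {n} (G : Graph n) where

  A : Fin n → Fin n → ℤ
  A u w = 𝟙 (adj G u w)

  A-sym : ∀ u w → A u w ≡ A w u
  A-sym u w = cong 𝟙 (Graph.sym G u w)

  A-diagonal : ∀ u → A u u ≡ 0ℤ
  A-diagonal u = cong 𝟙 (loopless G u)

  deg : Fin n → ℤ
  deg u = + degree G u

  deg≡∑A : ∀ u → deg u ≡ ∑[ w < n ] A u w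
  deg≡∑A u = length-filter-tabulate (T? ∘ adj G u) (λ w → w)

  -- For indicator vectors of S and T, ⟪ p , q ⟫ counts the ordered edges from S to T.
  ⟪_,_⟫ : (Fin n → ℤ) → (Fin n → ℤ) → ℤ
  ⟪ p , q ⟫ = ∑[ u < n ] ∑[ w < n ] (p u * (A u w * q w))

  private
    F : Fin n → Fin n → Fin n → ℤ
    F a b c = A a b * (A b c * A a c)

    F-swap₁₂ : ∀ a b c → F b a c ≡ F a b c
    F-swap₁₂ a b c rewrite A-sym b a = permute (A a b) (A b c) (A a c)
      where
      permute : ∀ x y z → x * (z * y) ≡ x * (y * z)
      permute = solve-∀

    F-swap₂₃ : ∀ a b c → F a c b ≡ F a b c
    F-swap₂₃ a b c rewrite A-sym c b = permute (A a b) (A b c) (A a c)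
      where
      permute : ∀ x y z → z * (y * x) ≡ x * (y * z)
      permute = solve-∀

    F-diagonal : ∀ a c → F a a c ≡ 0ℤ
    F-diagonal a c rewrite A-diagonal a = refl

    triangle-indicator : ∀ a b c → 𝟙 (does (isTriangle? G (a , b , c))) ≡ ordered F a b c
    triangle-indicator a b c =
      trans (𝟙-∧ (does (toℕ a <? toℕ b)) _) (cong (ord (toℕ a) (toℕ b) *_)
        (trans (𝟙-∧ (does (toℕ b <? toℕ c)) _) (cong (ord (toℕ b) (toℕ c) *_)
          (trans (𝟙-∧ (adj G a b) _) (cong (A a b *_) (𝟙-∧ (adj G b c) (adj G a c)))))))

  six-triangles : + 6 * + numTriangles G ≡ ∑[ v < n ] ⟪ A v , A v ⟫
  six-triangles = begin
    + 6 * + numTriangles G     ≡⟨ cong (+ 6 *_) (length-filter-triples (isTriangle? G)) ⟩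
    + 6 * ∑³ (λ a b c → 𝟙 (does (isTriangle? G (a , b , c)))) ≡⟨ cong (+ 6 *_) (∑³-cong triangle-indicator) ⟩
    + 6 * ∑³ (ordered F)       ≡⟨ ∑³-symmetric F F-swap₁₂ F-swap₂₃ F-diagonal ⟨
    ∑³ F                       ∎
    where open ≡-Reasoning

  ⟪⟫-comm : ∀ p q → ⟪ p , q ⟫ ≡ ⟪ q , p ⟫
  ⟪⟫-comm p q = trans (∑-comm (λ u w → p u * (A u w * q w))) (sum-cong-≗ λ w → sum-cong-≗ λ u → swap u w)
    where
    reorder : ∀ x a y → x * (a * y) ≡ y * (a * x)
    reorder = solve-∀
    swap : ∀ u w → p u * (A u w * q w) ≡ q w * (A w u * p u)
    swap u w rewrite A-sym u w = reorder (p u) (A w u) (q w)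

  ⟪⟫-distribʳ-+ : ∀ p q r → ⟪ p , (λ w → q w + r w) ⟫ ≡ ⟪ p , q ⟫ + ⟪ p , r ⟫
  ⟪⟫-distribʳ-+ p q r =
    trans (sum-cong-≗ λ u → trans (sum-cong-≗ λ w → distrib (p u) (A u w) (q w) (r w)) (∑-distrib-+ (term q u) (term r u)))
          (∑-distrib-+ (λ u → sum (term q u)) (λ u → sum (term r u)))
    where
    term : (Fin n → ℤ) → Fin n → Fin n → ℤ
    term s u w = p u * (A u w * s w)
    distrib : ∀ x a y z → x * (a * (y + z)) ≡ x * (a * y) + x * (a * z)
    distrib = solve-∀

  ⟪⟫-one : ∀ p → ⟪ p , (λ _ → 1ℤ) ⟫ ≡ ∑[ u < n ] (p u * deg u)
  ⟪⟫-one p = sum-cong-≗ λ u → begin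
    ∑[ w < n ] (p u * (A u w * 1ℤ)) ≡⟨ sum-cong-≗ (λ w → cong (p u *_) (ℤ.*-identityʳ (A u w))) ⟩
    ∑[ w < n ] (p u * A u w)        ≡⟨ *-distribˡ-sum (p u) (A u) ⟨
    p u * ∑[ w < n ] A u w          ≡⟨ cong (p u *_) (deg≡∑A u) ⟨
    p u * deg u                     ∎
    where open ≡-Reasoning

  ⟪⟫-δ : ∀ p v → ⟪ p , (λ w → δ w v) ⟫ ≡ ∑[ u < n ] (p u * A v u)
  ⟪⟫-δ p v = sum-cong-≗ λ u → begin
    ∑[ w < n ] (p u * (A u w * δ w v)) ≡⟨ sum-cong-≗ (λ w → reorder (p u) (A u w) (δ w v)) ⟩
    ∑[ w < n ] (δ w v * (p u * A u w)) ≡⟨ ∑-δ (λ w → p u * A u w) v ⟩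
    p u * A u v                        ≡⟨ cong (p u *_) (A-sym u v) ⟩
    p u * A v u                        ∎
    where
    open ≡-Reasoning
    reorder : ∀ x a d → x * (a * d) ≡ d * (x * a)
    reorder = solve-∀

  ⟪⟫-indicator-≤ : (b : Fin n → Bool) → let r = ∑[ u < n ] 𝟙 (b u) in ⟪ 𝟙 ∘ b , 𝟙 ∘ b ⟫ ≤ r * r - r
  ⟪⟫-indicator-≤ b = begin
    ⟪ y , y ⟫                                                    ≤⟨ ∑-mono-≤ (λ u → ∑-mono-≤ (pointwise u)) ⟩
    ∑[ u < n ] ∑[ w < n ] (y u * y w - δ w u * (y u * y w))     ≡⟨ sum-cong-≗ row ⟩
    ∑[ u < n ] (y u * r - y u)                                  ≡⟨ ∑-distrib-- (λ u → y u * r) y ⟩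
    ∑[ u < n ] (y u * r) - r                                    ≡⟨ cong (_- r) (*-distribʳ-sum r y) ⟨
    r * r - r                                                   ∎
    where
    open ℤ.≤-Reasoning
    y : Fin n → ℤ
    y = 𝟙 ∘ b
    r : ℤ
    r = ∑[ u < n ] y u

    diagonal : ∀ c → 𝟙 c * (0ℤ * 𝟙 c) ≤ 𝟙 c * 𝟙 c - 1ℤ * (𝟙 c * 𝟙 c)
    diagonal true  = ℤ.≤-refl
    diagonal false = ℤ.≤-refl

    off-diagonal : ∀ c a d → 𝟙 c * (𝟙 a * 𝟙 d) ≤ 𝟙 c * 𝟙 d - 0ℤ * (𝟙 c * 𝟙 d)
    off-diagonal false a     d     = ℤ.≤-refl
    off-diagonal true  true  false = ℤ.≤-refl
    off-diagonal true  false false = ℤ.≤-refl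
    off-diagonal true  true  true  = ℤ.≤-refl
    off-diagonal true  false true  = +≤+ z≤n

    pointwise : ∀ u w → y u * (A u w * y w) ≤ y u * y w - δ w u * (y u * y w)
    pointwise u w with w ≟ u
    ... | yes refl rewrite A-diagonal w = diagonal (b w)
    ... | no _ = off-diagonal (b u) (adj G u w) (b w)

    row : ∀ u → ∑[ w < n ] (y u * y w - δ w u * (y u * y w)) ≡ y u * r - y u
    row u = trans (∑-distrib-- (λ w → y u * y w) (λ w → δ w u * (y u * y w)))
                  (cong₂ _-_ (sym (*-distribˡ-sum (y u) y)) (trans (∑-δ (λ w → y u * y w) u) (𝟙-idem (b u))))

  ⟪⟫-congʳ : ∀ p {q r} → (∀ w → q w ≡ r w) → ⟪ p , q ⟫ ≡ ⟪ p , r ⟫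
  ⟪⟫-congʳ p q≡r = sum-cong-≗ λ u → sum-cong-≗ λ w → cong (λ z → p u * (A u w * z)) (q≡r w)

  module Neighbourhood (v : Fin n) where

    nonNeighbour : Fin n → Bool
    nonNeighbour u = not (adj G v u) ∧ not (does (u ≟ v))

    x y : Fin n → ℤ
    x = A v
    y = 𝟙 ∘ nonNeighbour

    partition : ∀ u → x u + y u + δ u v ≡ 1ℤ
    partition u with adj G v u in v~u | u ≟ v
    ... | true  | yes refl = contradiction (trans (sym v~u) (loopless G v)) λ ()
    ... | true  | no _     = refl
    ... | false | yes refl = refl
    ... | false | no _     = refl

    nonNeighbour-neighbour : ∀ u → y u * x u ≡ 0ℤ
    nonNeighbour-neighbour u with adj G v u
    ... | true  = refl
    ... | false = ℤ.*-zeroʳ (𝟙 (not (does (u ≟ v))))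

    ∑-partition : ∀ q → ∑[ u < n ] q u ≡ ∑[ u < n ] (x u * q u) + ∑[ u < n ] (y u * q u) + q v
    ∑-partition q = begin
      ∑[ u < n ] q u                                     ≡⟨ sum-cong-≗ split ⟩
      ∑[ u < n ] (x u * q u + y u * q u + δ u v * q u)   ≡⟨ ∑-distrib-+ (λ u → x u * q u + y u * q u) (λ u → δ u v * q u) ⟩
      ∑[ u < n ] (x u * q u + y u * q u) + ∑[ u < n ] (δ u v * q u)
        ≡⟨ cong₂ _+_ (∑-distrib-+ (λ u → x u * q u) (λ u → y u * q u)) (∑-δ q v) ⟩
      ∑[ u < n ] (x u * q u) + ∑[ u < n ] (y u * q u) + q v ∎
      where
      open ≡-Reasoning
      distrib : ∀ a b d c → (a + b + d) * c ≡ a * c + b * c + d * c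
      distrib = solve-∀
      split : ∀ u → q u ≡ x u * q u + y u * q u + δ u v * q u
      split u = trans (sym (trans (cong (_* q u) (partition u)) (ℤ.*-identityˡ (q u)))) (distrib (x u) (y u) (δ u v) (q u))

    ∑-nonNeighbour : ∑[ u < n ] y u ≡ + n - 1ℤ - deg v
    ∑-nonNeighbour = isolate (+ n) counted
      where
      open ≡-Reasoning
      isolate : ∀ {s d} m → m ≡ d + s + 1ℤ → s ≡ m - 1ℤ - d
      isolate {s} {d} _ refl = cancel s d
        where
        cancel : ∀ s d → s ≡ d + s + 1ℤ - 1ℤ - d
        cancel = solve-∀
      counted : + n ≡ deg v + ∑[ u < n ] y u + 1ℤ
      counted = begin
        + n                   ≡⟨ ℤ.*-identityʳ (+ n) ⟨
        + n * 1ℤ              ≡⟨ ∑-const n 1ℤ ⟨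
        ∑[ u < n ] 1ℤ         ≡⟨ ∑-partition (λ _ → 1ℤ) ⟩
        ∑[ u < n ] (x u * 1ℤ) + ∑[ u < n ] (y u * 1ℤ) + 1ℤ
          ≡⟨ cong₂ (λ a b → a + b + 1ℤ) (trans (sum-cong-≗ (ℤ.*-identityʳ ∘ x)) (sym (deg≡∑A v)))
                                         (sum-cong-≗ (ℤ.*-identityʳ ∘ y)) ⟩
        deg v + ∑[ u < n ] y u + 1ℤ ∎

    degree-split : ∀ p → ∑[ u < n ] (p u * deg u) ≡ ⟪ p , x ⟫ + ⟪ p , y ⟫ + ∑[ u < n ] (p u * x u)
    degree-split p = begin
      ∑[ u < n ] (p u * deg u)                   ≡⟨ ⟪⟫-one p ⟨
      ⟪ p , (λ _ → 1ℤ) ⟫                         ≡⟨ ⟪⟫-congʳ p (sym ∘ partition) ⟩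
      ⟪ p , (λ w → x w + y w + δ w v) ⟫          ≡⟨ ⟪⟫-distribʳ-+ p (λ w → x w + y w) (λ w → δ w v) ⟩
      ⟪ p , (λ w → x w + y w) ⟫ + ⟪ p , (λ w → δ w v) ⟫ ≡⟨ cong₂ _+_ (⟪⟫-distribʳ-+ p x y) (⟪⟫-δ p v) ⟩
      ⟪ p , x ⟫ + ⟪ p , y ⟫ + ∑[ u < n ] (p u * x u) ∎
      where open ≡-Reasoning

    neighbourhood-identity :
      ⟪ x , x ⟫ ≡ + 2 * ∑[ u < n ] (x u * deg u) - ∑[ u < n ] deg u + ⟪ y , y ⟫
    neighbourhood-identity = eliminate
      (trans (degree-split x) (cong (_+_ (⟪ x , x ⟫ + ⟪ x , y ⟫)) ∑x²))
      (trans (degree-split y) (cong₂ (λ a b → a + ⟪ y , y ⟫ + b) (⟪⟫-comm y x) ∑yx))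
      (∑-partition deg)
      where
      ∑x² : ∑[ u < n ] (x u * x u) ≡ deg v
      ∑x² = trans (sum-cong-≗ (𝟙-idem ∘ adj G v)) (sym (deg≡∑A v))
      ∑yx : ∑[ u < n ] (y u * x u) ≡ 0ℤ
      ∑yx = trans (sum-cong-≗ nonNeighbour-neighbour) (sum-replicate-zero n)
      eliminate : ∀ {P M Q d X Y S} → X ≡ P + M + d → Y ≡ M + Q + 0ℤ → S ≡ X + Y + d → P ≡ + 2 * X - S + Q
      eliminate {P} {M} {Q} {d} refl refl refl = cancel P M Q d
        where
        cancel : ∀ P M Q d → P ≡ + 2 * (P + M + d) - (P + M + d + (M + Q + 0ℤ) + d) + Q
        cancel = solve-∀

    neighbourhood-bound :
      let r = + n - 1ℤ - deg v in
      ⟪ x , x ⟫ ≤ + 2 * ∑[ u < n ] (x u * deg u) - ∑[ u < n ] deg u + (r * r - r)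
    neighbourhood-bound = begin
      ⟪ x , x ⟫                ≡⟨ neighbourhood-identity ⟩
      D + ⟪ y , y ⟫            ≤⟨ ℤ.+-monoʳ-≤ D (⟪⟫-indicator-≤ nonNeighbour) ⟩
      D + (∑y * ∑y - ∑y)       ≡⟨ cong (λ r → D + (r * r - r)) ∑-nonNeighbour ⟩
      D + (r * r - r)          ∎
      where
      open ℤ.≤-Reasoning
      D ∑y r : ℤ
      D = + 2 * ∑[ u < n ] (x u * deg u) - ∑[ u < n ] deg u
      ∑y = ∑[ u < n ] y u
      r = + n - 1ℤ - deg v

  ∑-neighbours : (q : Fin n → ℤ) → ∑[ v < n ] ∑[ u < n ] (A v u * q u) ≡ ∑[ u < n ] (deg u * q u)
  ∑-neighbours q = trans (∑-comm (λ v u → A v u * q u)) (sum-cong-≗ λ u → begin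
    ∑[ v < n ] (A v u * q u)   ≡⟨ *-distribʳ-sum (q u) (λ v → A v u) ⟨
    ∑[ v < n ] A v u * q u     ≡⟨ cong (_* q u) (trans (sum-cong-≗ λ v → A-sym v u) (sym (deg≡∑A u))) ⟩
    deg u * q u                ∎)
    where open ≡-Reasoning

  goodman-bound : + 6 * + numTriangles G ≤ ∑[ v < n ] goodman (+ n) (deg v)
  goodman-bound = begin
    + 6 * + numTriangles G                  ≡⟨ six-triangles ⟩
    ∑[ v < n ] ⟪ A v , A v ⟫            ≤⟨ ∑-mono-≤ (λ v → Neighbourhood.neighbourhood-bound v) ⟩
    ∑[ v < n ] (+ 2 * X v - S + h v)        ≡⟨ ∑-combination X (λ _ → S) h ⟩
    + 2 * ∑[ v < n ] X v - ∑[ v < n ] S + ∑[ v < n ] h v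
      ≡⟨ cong₂ (λ a b → + 2 * a - b + ∑[ v < n ] h v) (∑-neighbours d) (trans (∑-const n S) (*-distribˡ-sum (+ n) d)) ⟩
    + 2 * ∑[ v < n ] (d v * d v) - ∑[ v < n ] (+ n * d v) + ∑[ v < n ] h v
      ≡⟨ ∑-combination (λ v → d v * d v) (λ v → + n * d v) h ⟨
    ∑[ v < n ] (+ 2 * (d v * d v) - + n * d v + h v)  ≡⟨ sum-cong-≗ (λ v → expand (+ n) (d v)) ⟩
    ∑[ v < n ] goodman (+ n) (d v)           ∎
    where
    open ℤ.≤-Reasoning
    d : Fin n → ℤ
    d = deg
    X : Fin n → ℤ
    X v = ∑[ u < n ] (A v u * d u)
    S : ℤ
    S = ∑[ u < n ] d u
    h : Fin n → ℤ
    h v = (+ n - 1ℤ - d v) * (+ n - 1ℤ - d v) - (+ n - 1ℤ - d v)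
    expand : ∀ m e → + 2 * (e * e) - m * e + ((m - 1ℤ - e) * (m - 1ℤ - e) - (m - 1ℤ - e)) ≡ goodman m e
    expand = solve-∀

goodman-near-regular : ∀ k s → let m = + 2 * k - + 1 - + 2 * s in
  m * goodman m (k - + 1) + (goodman m (k - + 2) - goodman m (k - + 1))
  ≡ m * ((k - + 1) * (k - + 2) - (k - + 1 - + 2 * s) * (+ 2 * s + + 1)) + + 3 - + 6 * s
goodman-near-regular = solve-∀

theorem9 : (k s : ℤ) → Σ ℤ (λ m → k ≡ + 2 * m) →
    (n : ℕ) → + n ≡ + 2 * k - + 1 - + 2 * s →
    (G : Graph n) →
    Σ (Fin n) (λ v₀ → (+ degree G v₀ ≡ k - + 2) ×
                      ((v : Fin n) → ¬ (v ≡ v₀) → + degree G v ≡ k - + 1)) →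
    + 6 * + numTriangles G
      ≤ (+ 2 * k - + 1 - + 2 * s) * ((k - + 1) * (k - + 2) - (k - + 1 - + 2 * s) * (+ 2 * s + + 1))
        + + 3 - + 6 * s
theorem9 k s _ n n≡ G (v₀ , deg-v₀ , deg-v) = begin
  + 6 * + numTriangles G                   ≤⟨ goodman-bound G ⟩
  ∑[ v < n ] goodman (+ n) (deg G v)       ≡⟨ ∑-almost-constant _ v₀ _ (λ v v≢v₀ → cong (goodman (+ n)) (deg-v v v≢v₀)) ⟩
  + n * goodman (+ n) (k - + 1) + (goodman (+ n) (deg G v₀) - goodman (+ n) (k - + 1))
    ≡⟨ cong₂ (λ m e → m * goodman m (k - + 1) + (goodman m e - goodman m (k - + 1))) n≡ deg-v₀ ⟩
  m * goodman m (k - + 1) + (goodman m (k - + 2) - goodman m (k - + 1)) ≡⟨ goodman-near-regular k s ⟩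
  m * ((k - + 1) * (k - + 2) - (k - + 1 - + 2 * s) * (+ 2 * s + + 1)) + + 3 - + 6 * s ∎
  where
  open ℤ.≤-Reasoning
  m : ℤ
  m = + 2 * k - + 1 - + 2 * s
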